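{- Let $\pi$ and $\pi'$ be permutations with $S(\pi)\cap S(\pi')=\emptyset$ and let $x\in S(\pi)$. Then $w(\pi[x\leftarrow\pi'])=\max(w(\pi),w(\pi'))$.
   Context: A permutation is a pair $\pi=(S,P)$, $S$ a finite set of positive integers, $P:S\to\mathbb{N}^2$ injective with $P(S)$ in general position. For $\alpha\in\{1,2\}$, $p<^{\pi}_{\alpha}p'$ means the $\alpha$-th coordinate of $P(p)$ is smaller than that of $P(p')$. Substitution: for $\pi=(S,P)$, $\pi'=(S',P')$ with $S\cap S'=\emptyset$ and $x\in S$, $\pi[x\leftarrow\pi']$ is a permutation $\pi''$ with $S(\pi'')=S\setminus\{x\}\cup S'$ such that for $\alpha\in\{1,2\}$: (i) for $p,p'\in S\setminus\{x\}$, $p<^{\pi''}_{\alpha}p'$ iff $p<^{\pi}_{\alpha}p'$; (ii) for $p,p'\in S'$, $p<^{\pi''}_{\alpha}p'$ iff $p<^{\pi'}_{\alpha}p'$; (iii) for $p\in S\setminus\{x\}$, $p'\in S'$, $p<^{\pi''}_{\alpha}p'$ iff $p<^{\pi}_{\alpha}x$. Intervals are discrete; a rectangle is $R=I_1(R)\times I_2(R)$. A rectangle family is $\mathcal{R}=(S,R)$ assigning a rectangle to each index of a finite $S\subseteq\mathbb{N}$; a permutation is the family $R(i)=\{P(i)\}$. $\mathcal{R}[i,j\to k]$ ($k\notin S$) replaces $R(i),R(j)$ by their bounding box indexed $k$. A decomposition of $\pi$ is $(\mathcal{R}_0,\dots,\mathcal{R}_s)$ with $\mathcal{R}_0=\pi$,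 $\max S<k_1<\dots<k_s$, $\mathcal{R}_p=\mathcal{R}_{p-1}[i,j\to k_p]$ for some $i,j$, $|\mathcal{R}_s|=1$. $R,R'$ $\alpha$-view each other if $I_\alpha(R)\cap I_\alpha(R')\neq\emptyset$; $\mathrm{view}(\mathcal{R},i)=\max_\alpha|\{j\ne i: R(i),R(j)\ \alpha\text{ -view each other}\}|$; $\mathcal{R}$ is $d$-wide if $\mathrm{view}(\mathcal{R},i)<d$ for every $i$; a decomposition is $d$-wide if all its families are; $w(\pi)$ is the minimum $d$ such that $\pi$ has a $d$-wide decomposition. -}

module Defs where

open import Data.Nat using (ℕ; zero; suc; _<_; _≤_; _⊔_; _⊓_; _≤ᵇ_)
open import Data.Bool using (Bool; true; false; _∧_; if_then_else_)
open import Data.Product using (Σ; ∃; ∃-syntax; _×_; _,_; proj₁; proj₂)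
open import Data.Sum using (_⊎_)
open import Data.List using (List; []; _∷_; _++_; map; length; foldr)
open import Data.List.Membership.Propositional using (_∈_)
open import Data.List.Relation.Unary.All using (All)
open import Data.List.Relation.Unary.Unique.Propositional using (Unique)
open import Data.List.Relation.Binary.Permutation.Propositional using (_↭_)
open import Relation.Binary.PropositionalEquality using (_≡_; _≢_)
open import Relation.Nullary using (¬_)
open import Function.Bundles using (_⇔_)

data Axis : Set where
  ax1 ax2 : Axis

Point : Set
Point = ℕ × ℕ

coord : Axis → Point → ℕ
coord ax1 (a , b) = a
coord ax2 (a , b) = b

-- Permutations π = (S, P): a finite list of entries (index , P(index)),
-- with pairwise distinct positive indices (so P is a function on the
-- finite set S), injective P in general position (pairwise distinct
-- first coordinates and pairwise distinct second coordinates).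

record Permutation : Set where
  field
    entries     : List (ℕ × Point)
    indicesPos  : All (λ e → 0 < proj₁ e) entries
    indicesUniq : Unique (map proj₁ entries)
    xsUniq      : Unique (map (λ e → coord ax1 (proj₂ e)) entries)
    ysUniq      : Unique (map (λ e → coord ax2 (proj₂ e)) entries)
open Permutation public

_∈S_ : ℕ → Permutation → Set
p ∈S π = p ∈ map proj₁ (entries π)

Lt : Permutation → Axis → ℕ → ℕ → Set
Lt π α p q = ∃[ c ] ∃[ c' ] ((p , c) ∈ entries π × (q , c') ∈ entries π
                            × coord α c < coord α c')

-- π'' is (a realisation of) the substitution π[x ← π']
IsSubstitution : Permutation → ℕ → Permutation → Permutation → Set
IsSubstitution π x π' π'' =
    (∀ p → p ∈S π'' ⇔ ((p ∈S π × p ≢ x) ⊎ p ∈S π'))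
  × (∀ α → ∀ p q → p ∈S π → p ≢ x → q ∈S π → q ≢ x →
       Lt π'' α p q ⇔ Lt π α p q)
  × (∀ α → ∀ p q → p ∈S π' → q ∈S π' →
       Lt π'' α p q ⇔ Lt π' α p q)
  × (∀ α → ∀ p q → p ∈S π → p ≢ x → q ∈S π' →
       Lt π'' α p q ⇔ Lt π α p x)

-- discrete interval [lo , hi]
Interval : Set
Interval = ℕ × ℕ

Rect : Set
Rect = Interval × Interval

interval : Axis → Rect → Interval
interval ax1 (I , J) = I
interval ax2 (I , J) = J

hull : Interval → Interval → Interval
hull (a , b) (c , d) = (a ⊓ c , b ⊔ d)

boundingBox : Rect → Rect → Rect
boundingBox (I , J) (I' , J') = (hull I I' , hull J J')

meets : Interval → Interval → Bool
meets (a , b) (c , d) = (a ≤ᵇ d) ∧ (c ≤ᵇ b)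

Family : Set
Family = List (ℕ × Rect)

indices : Family → List ℕ
indices = map proj₁

maxIndex : Family → ℕ
maxIndex F = foldr _⊔_ 0 (indices F)

toFamily : Permutation → Family
toFamily π = map (λ e → (proj₁ e , ((coord ax1 (proj₂ e) , coord ax1 (proj₂ e))
                                   , (coord ax2 (proj₂ e) , coord ax2 (proj₂ e)))))
                 (entries π)

countView : Axis → Rect → Family → ℕ
countView α r [] = 0
countView α r ((j , r') ∷ L) =
  if meets (interval α r) (interval α r') then suc (countView α r L)
  else countView α r L

-- view(R , i), where R = A ++ (i , r) ∷ B (the other members are A ++ B)
view : Family → (i : ℕ) → Rect → Family → ℕ
view A i r B = countView ax1 r (A ++ B) ⊔ countView ax2 r (A ++ B)

Wide : ℕ → Family → Set
Wide d F = ∀ A i r B → F ≡ A ++ (i , r) ∷ B → view A i r B < d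

-- A d-wide decomposition starting from family F, where every new index
-- must exceed m (the last index used, initially max S).
-- The step replaces R(i), R(j) (i ≠ j, guaranteed by uniqueness of indices)
-- by their bounding box indexed k:  F = (i,r)∷(j,r')∷G up to reordering,
-- and F[i,j→k] = (k , bbox r r') ∷ G.
data WideDecompFrom (d : ℕ) : Family → ℕ → Set where
  done : ∀ {F m} → Wide d F → length F ≡ 1 → WideDecompFrom d F m
  step : ∀ {F m} i j k r r' G →
         Wide d F →
         F ↭ ((i , r) ∷ (j , r') ∷ G) →
         m < k →
         WideDecompFrom d ((k , boundingBox r r') ∷ G) k →
         WideDecompFrom d F m

HasWideDecomp : ℕ → Permutation → Set
HasWideDecomp d π = WideDecompFrom d (toFamily π) (maxIndex (toFamily π))

IsWidth : Permutation → ℕ → Set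
IsWidth π d = HasWideDecomp d π × (∀ d' → HasWideDecomp d' π → d ≤ d')

-- Widths can be compared through shadows: given a monotone correspondence between the points
-- of two families, a decomposition of one is replayed on the other by replacing each rectangle
-- with the bounding box of the corresponding points.  Shadows that view each other come from
-- rectangles that view each other, so the width does not grow.  Restricting a decomposition of
-- π'' = π[x ← π'] to S(π') gives w(π') ≤ w(π''), and collapsing S(π') onto one of its points
-- gives w(π) ≤ w(π'').  Conversely, S(π') is an interval of π'' on both axes, so the boxes built
-- by a decomposition of π' never view the remaining points of π''; once S(π') is a single box,
-- a decomposition of π with that box in place of x finishes the job.

module Submission where

open import Defs
open import Data.Nat using (ℕ; suc; _+_; _<_; _≤_; _⊔_; _⊓_; _≤ᵇ_; _≟_; z≤n; s≤s)
open import Data.Nat.Properties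
open import Data.Bool using (true; false; if_then_else_)
open import Data.Bool.Properties using (T-≡; T-∧; ∧-comm)
open import Data.Maybe as Maybe using (Maybe; just; nothing)
open import Data.Product using (∃-syntax; _×_; _,_; proj₁; proj₂)
open import Data.Sum using (_⊎_; inj₁; inj₂)
open import Data.Empty using (⊥; ⊥-elim)
open import Data.Unit using (⊤; tt)
open import Data.List using (List; []; _∷_; _++_; map; mapMaybe)
open import Data.List.Properties using (map-++; map-∘; ++-assoc; ++-identityʳ; mapMaybe-++; mapMaybe-map)
open import Data.List.Membership.Propositional using (_∈_; _∉_)
open import Data.List.Membership.Propositional.Properties using (∈-map⁺; ∈-map⁻; ∈-++⁺ʳ; ∈-++⁻; ∈-∃++)
open import Data.List.Relation.Binary.Subset.Propositional using (_⊆_)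
open import Data.List.Relation.Unary.Any using (here; there)
open import Data.List.Relation.Unary.All as All using (All; []; _∷_)
open import Data.List.Relation.Unary.AllPairs using ([]; _∷_)
open import Data.List.Relation.Unary.Unique.Propositional using (Unique)
import Data.List.Relation.Unary.Unique.Propositional.Properties as Unique
open import Data.List.Relation.Binary.Permutation.Propositional as ↭
  using (_↭_; ↭-sym; ↭-trans; ↭-refl; ↭-reflexive)
open import Data.List.Relation.Binary.Permutation.Propositional.Properties
  using (↭-map-inv; ↭-singleton-inv; ∈-resp-↭; drop-∷; shift; ↭-length; All-resp-↭; ++⁺ˡ; ++⁺ʳ; mapMaybe-↭)
open import Relation.Binary.PropositionalEquality
  using (_≡_; _≢_; refl; sym; trans; cong; cong₂; subst; subst₂; module ≡-Reasoning)
open import Relation.Binary.Definitions using (tri<; tri≈; tri>)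
open import Relation.Nullary using (¬_; yes; no)
open import Function.Base using (_∘_)
open import Function.Bundles using (_⇔_; Equivalence)

Unique-map-injective : ∀ {A B : Set} (f : A → B) {xs : List A} {a b : A} →
  Unique (map f xs) → a ∈ xs → b ∈ xs → f a ≡ f b → a ≡ b
Unique-map-injective f (h ∷ u) (here refl) (here refl) e = refl
Unique-map-injective f (h ∷ u) (here refl) (there b) e = ⊥-elim (All.lookup h (∈-map⁺ f b) e)
Unique-map-injective f (h ∷ u) (there a) (here refl) e = ⊥-elim (All.lookup h (∈-map⁺ f a) (sym e))
Unique-map-injective f (h ∷ u) (there a) (there b) e = Unique-map-injective f u a b e

module _ {A : Set} where

  ∈-++∷⁺ : ∀ (xs : List A) {ys y z} → z ∈ xs ++ ys → z ∈ xs ++ y ∷ ys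
  ∈-++∷⁺ [] p = there p
  ∈-++∷⁺ (x ∷ xs) (here p) = here p
  ∈-++∷⁺ (x ∷ xs) (there p) = there (∈-++∷⁺ xs p)

  ∈-++∷⁻ : ∀ (xs : List A) {ys y z} → z ∈ xs ++ y ∷ ys → z ≢ y → z ∈ xs ++ ys
  ∈-++∷⁻ [] (here p) z≢y = ⊥-elim (z≢y p)
  ∈-++∷⁻ [] (there p) _ = p
  ∈-++∷⁻ (x ∷ xs) (here p) _ = here p
  ∈-++∷⁻ (x ∷ xs) (there p) z≢y = there (∈-++∷⁻ xs p z≢y)

  Unique-++∷⇒∉ : ∀ (xs : List A) {ys y} → Unique (xs ++ y ∷ ys) → y ∉ xs ++ ys
  Unique-++∷⇒∉ [] (h ∷ _) p = All.lookup h p refl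
  Unique-++∷⇒∉ (x ∷ xs) (h ∷ _) (here refl) = All.lookup h (∈-++⁺ʳ xs (here refl)) refl
  Unique-++∷⇒∉ (x ∷ xs) (_ ∷ u) (there p) = Unique-++∷⇒∉ xs u p

  Unique-++∷⇒Unique-++ : ∀ (xs : List A) {ys y} → Unique (xs ++ y ∷ ys) → Unique (xs ++ ys)
  Unique-++∷⇒Unique-++ [] (_ ∷ u) = u
  Unique-++∷⇒Unique-++ (x ∷ xs) (h ∷ u) =
    All.tabulate (λ p → All.lookup h (∈-++∷⁺ xs p)) ∷ Unique-++∷⇒Unique-++ xs u

  Unique-⊆-⊇⇒↭ : ∀ {xs ys : List A} → Unique xs → Unique ys → xs ⊆ ys → ys ⊆ xs → xs ↭ ys
  Unique-⊆-⊇⇒↭ {[]} {[]} _ _ _ _ = ↭-refl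
  Unique-⊆-⊇⇒↭ {[]} {y ∷ ys} _ _ _ ys⊆xs with () ← ys⊆xs (here refl)
  Unique-⊆-⊇⇒↭ {x ∷ xs} (h ∷ ux) uy xs⊆ys ys⊆xs with ∈-∃++ (xs⊆ys (here refl))
  ... | as , bs , refl =
    ↭-trans (↭.prep x (Unique-⊆-⊇⇒↭ ux (Unique-++∷⇒Unique-++ as uy) xs⊆as++bs as++bs⊆xs))
            (↭-sym (shift x as bs))
    where
    xs⊆as++bs : xs ⊆ as ++ bs
    xs⊆as++bs p = ∈-++∷⁻ as (xs⊆ys (there p)) (λ e → All.lookup h p (sym e))
    as++bs⊆xs : as ++ bs ⊆ xs
    as++bs⊆xs p with ys⊆xs (∈-++∷⁺ as p)
    ... | here refl = ⊥-elim (Unique-++∷⇒∉ as uy p)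
    ... | there q = q

module _ {A B : Set} (f : A → Maybe B) where

  ∈-mapMaybe⁺ : ∀ {xs a b} → a ∈ xs → f a ≡ just b → b ∈ mapMaybe f xs
  ∈-mapMaybe⁺ {x ∷ xs} (here refl) fa≡b rewrite fa≡b = here refl
  ∈-mapMaybe⁺ {x ∷ xs} (there p) fa≡b with f x
  ... | nothing = ∈-mapMaybe⁺ p fa≡b
  ... | just _ = there (∈-mapMaybe⁺ p fa≡b)

  ∈-mapMaybe⁻ : ∀ {xs b} → b ∈ mapMaybe f xs → ∃[ a ] (a ∈ xs × f a ≡ just b)
  ∈-mapMaybe⁻ {x ∷ xs} p with f x in fx≡
  ∈-mapMaybe⁻ {x ∷ xs} p | nothing with a , q , e ← ∈-mapMaybe⁻ p = a , there q , e
  ∈-mapMaybe⁻ {x ∷ xs} (here refl) | just _ = x , here refl , fx≡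
  ∈-mapMaybe⁻ {x ∷ xs} (there p) | just _ with a , q , e ← ∈-mapMaybe⁻ p = a , there q , e

  Unique-mapMaybe : ∀ {C : Set} (g : A → C) {xs} → Unique (map g xs) →
    (∀ {a b r} → a ∈ xs → b ∈ xs → f a ≡ just r → f b ≡ just r → g a ≡ g b) →
    Unique (mapMaybe f xs)
  Unique-mapMaybe g {[]} _ _ = []
  Unique-mapMaybe g {x ∷ xs} (h ∷ u) same with f x in fx≡
  ... | nothing = Unique-mapMaybe g u (λ a b → same (there a) (there b))
  ... | just y = All.tabulate y∉ ∷ Unique-mapMaybe g u (λ a b → same (there a) (there b))
    where
    y∉ : ∀ {z} → z ∈ mapMaybe f xs → y ≢ z
    y∉ p refl with a , q , e ← ∈-mapMaybe⁻ p = All.lookup h (∈-map⁺ g q) (same (here refl) (there q) fx≡ e)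

  map-↭-mapMaybe-++ : ∀ (g : A → Maybe B) (h : A → B) xs →
    (∀ a → (f a ≡ just (h a) × g a ≡ nothing) ⊎ (f a ≡ nothing × g a ≡ just (h a))) →
    map h xs ↭ mapMaybe f xs ++ mapMaybe g xs
  map-↭-mapMaybe-++ g h [] split = ↭-refl
  map-↭-mapMaybe-++ g h (a ∷ xs) split with split a
  ... | inj₁ (fa , ga) rewrite fa | ga = ↭.prep (h a) (map-↭-mapMaybe-++ g h xs split)
  ... | inj₂ (fa , ga) rewrite fa | ga =
    ↭-trans (↭.prep (h a) (map-↭-mapMaybe-++ g h xs split)) (↭-sym (shift (h a) (mapMaybe f xs) (mapMaybe g xs)))

meets⇒ : ∀ (I J : Interval) → meets I J ≡ true → proj₁ I ≤ proj₂ J × proj₁ J ≤ proj₂ I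
meets⇒ (a , b) (c , d) m with a≤d , c≤b ← Equivalence.to T-∧ (Equivalence.from T-≡ m) =
  ≤ᵇ⇒≤ a d a≤d , ≤ᵇ⇒≤ c b c≤b

meets⇐ : ∀ (I J : Interval) → proj₁ I ≤ proj₂ J → proj₁ J ≤ proj₂ I → meets I J ≡ true
meets⇐ (a , b) (c , d) a≤d c≤b = Equivalence.to T-≡ (Equivalence.from T-∧ (≤⇒≤ᵇ a≤d , ≤⇒≤ᵇ c≤b))

meets-sym : ∀ (I J : Interval) → meets I J ≡ meets J I
meets-sym (a , b) (c , d) = ∧-comm (a ≤ᵇ d) (c ≤ᵇ b)

lo hi : Axis → Rect → ℕ
lo α s = proj₁ (interval α s)
hi α s = proj₂ (interval α s)

lo-boundingBox : ∀ α s s' → lo α (boundingBox s s') ≡ lo α s ⊓ lo α s'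
lo-boundingBox ax1 s s' = refl
lo-boundingBox ax2 s s' = refl

hi-boundingBox : ∀ α s s' → hi α (boundingBox s s') ≡ hi α s ⊔ hi α s'
hi-boundingBox ax1 s s' = refl
hi-boundingBox ax2 s s' = refl

pt : Point → Rect
pt c = ((coord ax1 c , coord ax1 c) , (coord ax2 c , coord ax2 c))

interval-pt : ∀ α c → interval α (pt c) ≡ (coord α c , coord α c)
interval-pt ax1 c = refl
interval-pt ax2 c = refl

coord-pt-injective : ∀ α {c c'} → pt c ≡ pt c' → coord α c ≡ coord α c'
coord-pt-injective ax1 e = cong (lo ax1) e
coord-pt-injective ax2 e = cong (lo ax2) e

LowEnd HighEnd : (Point → Set) → Axis → Rect → Set
LowEnd L α s = ∃[ u ] (L u × coord α u ≡ lo α s)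
HighEnd U α s = ∃[ v ] (U v × coord α v ≡ hi α s)

Spanned : (L U : Point → Set) → Axis → Rect → Set
Spanned L U α s = LowEnd L α s × HighEnd U α s

Spanned-map : ∀ {L U L' U' : Point → Set} α {s} →
  (∀ {u} → L u → L' u) → (∀ {v} → U v → U' v) → Spanned L U α s → Spanned L' U' α s
Spanned-map α f g ((u , lu , eu) , (v , uv , ev)) = (u , f lu , eu) , (v , g uv , ev)

Spanned-pt : ∀ {L U : Point → Set} α {c} → L c → U c → Spanned L U α (pt c)
Spanned-pt α {c} lc uc =
  (c , lc , cong proj₁ (sym (interval-pt α c))) , (c , uc , cong proj₂ (sym (interval-pt α c)))

Spanned-boundingBox : ∀ {L U : Point → Set} α {s s'} →
  Spanned L U α s → Spanned L U α s' → Spanned L U α (boundingBox s s')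
Spanned-boundingBox α {s} {s'} ((u , lu , eu) , (v , uv , ev)) ((u' , lu' , eu') , (v' , uv' , ev')) =
  low (⊓-sel (lo α s) (lo α s')) , high (⊔-sel (hi α s) (hi α s'))
  where
  low : lo α s ⊓ lo α s' ≡ lo α s ⊎ lo α s ⊓ lo α s' ≡ lo α s' → LowEnd _ α (boundingBox s s')
  low (inj₁ e) = u , lu , trans eu (sym (trans (lo-boundingBox α s s') e))
  low (inj₂ e) = u' , lu' , trans eu' (sym (trans (lo-boundingBox α s s') e))
  high : hi α s ⊔ hi α s' ≡ hi α s ⊎ hi α s ⊔ hi α s' ≡ hi α s' → HighEnd _ α (boundingBox s s')
  high (inj₁ e) = v , uv , trans ev (sym (trans (hi-boundingBox α s s') e))
  high (inj₂ e) = v' , uv' , trans ev' (sym (trans (hi-boundingBox α s s') e))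

viewers : Axis → Rect → List Rect → ℕ
viewers α r [] = 0
viewers α r (r' ∷ L) = if meets (interval α r) (interval α r') then suc (viewers α r L) else viewers α r L

countView≡viewers : ∀ α r (F : Family) → countView α r F ≡ viewers α r (map proj₂ F)
countView≡viewers α r [] = refl
countView≡viewers α r ((j , r') ∷ F) with meets (interval α r) (interval α r')
... | true = cong suc (countView≡viewers α r F)
... | false = countView≡viewers α r F

viewers-++ : ∀ α r (xs ys : List Rect) → viewers α r (xs ++ ys) ≡ viewers α r xs + viewers α r ys
viewers-++ α r [] ys = refl
viewers-++ α r (x ∷ xs) ys with meets (interval α r) (interval α x)
... | true = cong suc (viewers-++ α r xs ys)
... | false = viewers-++ α r xs ys

viewers-↭ : ∀ α r {xs ys : List Rect} → xs ↭ ys → viewers α r xs ≡ viewers α r ys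
viewers-↭ α r ↭.refl = refl
viewers-↭ α r (↭.prep x p) with meets (interval α r) (interval α x)
... | true = cong suc (viewers-↭ α r p)
... | false = viewers-↭ α r p
viewers-↭ α r (↭.swap x y p) with meets (interval α r) (interval α x) | meets (interval α r) (interval α y)
... | true | true = cong (λ n → suc (suc n)) (viewers-↭ α r p)
... | true | false = cong suc (viewers-↭ α r p)
... | false | true = cong suc (viewers-↭ α r p)
... | false | false = viewers-↭ α r p
viewers-↭ α r (↭.trans p q) = trans (viewers-↭ α r p) (viewers-↭ α r q)

viewers-none : ∀ α r (xs : List Rect) →
  (∀ {x} → x ∈ xs → meets (interval α r) (interval α x) ≡ false) → viewers α r xs ≡ 0
viewers-none α r [] _ = refl
viewers-none α r (x ∷ xs) apart rewrite apart (here refl) = viewers-none α r xs (λ p → apart (there p))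

WideRects : ℕ → List Rect → Set
WideRects D L = ∀ r rest → L ↭ r ∷ rest → viewers ax1 r rest ⊔ viewers ax2 r rest < D

WideRects-resp-↭ : ∀ {D L L'} → L' ↭ L → WideRects D L → WideRects D L'
WideRects-resp-↭ L'↭L w r rest p = w r rest (↭-trans (↭-sym L'↭L) p)

WideRects-[] : ∀ {D} → WideRects D []
WideRects-[] r rest p with () ← ↭-length p

WideRects⇒Wide : ∀ {D} (F : Family) → WideRects D (map proj₂ F) → Wide D F
WideRects⇒Wide {D} F w A i r B refl =
  subst (_< D) (sym (cong₂ _⊔_ (countView≡viewers ax1 r (A ++ B)) (countView≡viewers ax2 r (A ++ B))))
    (w r (map proj₂ (A ++ B)) r-first)
  where
  r-first : map proj₂ (A ++ (i , r) ∷ B) ↭ r ∷ map proj₂ (A ++ B)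
  r-first rewrite map-++ proj₂ A ((i , r) ∷ B) | map-++ proj₂ A B = shift r (map proj₂ A) (map proj₂ B)

⊔-<-bound : ∀ {a b a' b' n} → a ≤ a' → b ≤ b' → a' ⊔ b' < n → a ⊔ b < n
⊔-<-bound a≤a' b≤b' = ≤-<-trans (⊔-mono-≤ a≤a' b≤b')

WideDecompFrom-∷⇒0< : ∀ {d e F m} → WideDecompFrom d (e ∷ F) m → 0 < d
WideDecompFrom-∷⇒0< (done w _) = ≤-trans (s≤s z≤n) (w [] _ _ _ refl)
WideDecompFrom-∷⇒0< (step _ _ _ _ _ _ w _ _ _) = ≤-trans (s≤s z≤n) (w [] _ _ _ refl)

singleton-WideDecompFrom : ∀ {D} (Σ : Family) s m → 0 < D → map proj₂ Σ ↭ s ∷ [] → WideDecompFrom D Σ m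
singleton-WideDecompFrom {D} Σ s m 0<D p with ↭-map-inv proj₂ p
... | (i , .s) ∷ [] , refl , q with refl ← ↭-singleton-inv q = done wide refl
  where
  wide : Wide D ((i , s) ∷ [])
  wide [] j r [] refl = 0<D
  wide (_ ∷ []) j r B ()
  wide (_ ∷ _ ∷ _) j r B ()

WideDecompFrom⇒Wide : ∀ {d F m} → WideDecompFrom d F m → Wide d F
WideDecompFrom⇒Wide (done w _) = w
WideDecompFrom⇒Wide (step _ _ _ _ _ _ w _ _ _) = w

WideDecompFrom-nonempty : ∀ {d F m} → WideDecompFrom d F m → ∃[ e ] (e ∈ F)
WideDecompFrom-nonempty {F = e ∷ _} _ = e , here refl
WideDecompFrom-nonempty {F = []} (done _ ())
WideDecompFrom-nonempty {F = []} (step _ _ _ _ _ _ _ p _ _) with () ← ↭-length p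

WideDecompFrom⇒0< : ∀ {d F m} → WideDecompFrom d F m → 0 < d
WideDecompFrom⇒0< dec with WideDecompFrom-nonempty dec
... | (i , r) , e∈F with ∈-∃++ e∈F
... | A , B , refl = ≤-<-trans z≤n (WideDecompFrom⇒Wide dec A i r B refl)

map-proj₂-↭-∷∷-inv : ∀ (Σ : Family) s₁ s₂ X → map proj₂ Σ ↭ s₁ ∷ s₂ ∷ X →
  ∃[ i ] ∃[ j ] ∃[ G ] (Σ ↭ (i , s₁) ∷ (j , s₂) ∷ G × map proj₂ G ≡ X)
map-proj₂-↭-∷∷-inv Σ s₁ s₂ X p with ↭-map-inv proj₂ p
... | (i , .s₁) ∷ (j , .s₂) ∷ G , refl , Σ↭ = i , j , G , Σ↭ , refl

module _ (ρ : Permutation) where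
  private E = entries ρ

  ∈S⇒entry : ∀ {p} → p ∈S ρ → ∃[ c ] ((p , c) ∈ E)
  ∈S⇒entry p∈ with (p , c) , e∈ , refl ← ∈-map⁻ proj₁ p∈ = c , e∈

  entry⇒∈S : ∀ {p c} → (p , c) ∈ E → p ∈S ρ
  entry⇒∈S = ∈-map⁺ proj₁

  entry-functional : ∀ {p c c'} → (p , c) ∈ E → (p , c') ∈ E → c ≡ c'
  entry-functional a b = cong proj₂ (Unique-map-injective proj₁ (indicesUniq ρ) a b refl)

  entry-coord-injective : ∀ α {p q c c'} → (p , c) ∈ E → (q , c') ∈ E →
    coord α c ≡ coord α c' → (p , c) ≡ (q , c')
  entry-coord-injective ax1 = Unique-map-injective (λ e → coord ax1 (proj₂ e)) (xsUniq ρ)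
  entry-coord-injective ax2 = Unique-map-injective (λ e → coord ax2 (proj₂ e)) (ysUniq ρ)

  coord-injective : ∀ α {p q c c'} → (p , c) ∈ E → (q , c') ∈ E → coord α c ≡ coord α c' → p ≡ q
  coord-injective α a b e = cong proj₁ (entry-coord-injective α a b e)

  Lt-elim : ∀ α {p q c c'} → Lt ρ α p q → (p , c) ∈ E → (q , c') ∈ E → coord α c < coord α c'
  Lt-elim α (_ , _ , a , b , lt) a' b' rewrite entry-functional a' a | entry-functional b' b = lt

  Lt-intro : ∀ α {p q c c'} → (p , c) ∈ E → (q , c') ∈ E → coord α c < coord α c' → Lt ρ α p q
  Lt-intro α {c = c} {c'} a b lt = c , c' , a , b , lt

  Lt-asym : ∀ α {p q} → Lt ρ α p q → Lt ρ α q p → ⊥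
  Lt-asym α l (_ , _ , a , b , lt) = <-asym (Lt-elim α l b a) lt

  Lt-total : ∀ α {p q c c'} → (p , c) ∈ E → (q , c') ∈ E → p ≢ q → Lt ρ α p q ⊎ Lt ρ α q p
  Lt-total α {c = c} {c'} a b p≢q with <-cmp (coord α c) (coord α c')
  ... | tri< l _ _ = inj₁ (Lt-intro α a b l)
  ... | tri≈ _ e _ = ⊥-elim (p≢q (coord-injective α a b e))
  ... | tri> _ _ g = inj₂ (Lt-intro α b a g)

  ≤⇒≡⊎Lt : ∀ α {p q c c'} → (p , c) ∈ E → (q , c') ∈ E → coord α c ≤ coord α c' →
    p ≡ q ⊎ Lt ρ α p q
  ≤⇒≡⊎Lt α a b le with m≤n⇒m<n∨m≡n le
  ... | inj₁ l = inj₂ (Lt-intro α a b l)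
  ... | inj₂ e = inj₁ (coord-injective α a b e)

  ≤⇒Lt : ∀ α {p q c c'} → p ≢ q → (p , c) ∈ E → (q , c') ∈ E → coord α c ≤ coord α c' → Lt ρ α p q
  ≤⇒Lt α p≢q a b le with ≤⇒≡⊎Lt α a b le
  ... | inj₁ p≡q = ⊥-elim (p≢q p≡q)
  ... | inj₂ l = l

  points : List Rect
  points = map (λ e → pt (proj₂ e)) E

  points-rects : map proj₂ (toFamily ρ) ≡ points
  points-rects = sym (map-∘ E)

  points-unique : Unique points
  points-unique = Unique.map⁻ (subst Unique (map-∘ {g = lo ax1} E) (xsUniq ρ))

  HasWideDecomp-nonempty : ∀ {d} → HasWideDecomp d ρ → ∃[ e ] (e ∈ E)
  HasWideDecomp-nonempty dec with WideDecompFrom-nonempty dec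
  ... | _ , e∈ with ∈-map⁻ _ e∈
  ... | e , e∈E , _ = e , e∈E

  -- any two points of a permutation are apart on both axes
  points-WideRects : ∀ {D} (L : List Rect) → 0 < D → Unique L → L ⊆ points → WideRects D L
  points-WideRects {D} L 0<D uL L⊆ r rest p
    with A , B , refl ← ∈-∃++ (∈-resp-↭ (↭-sym p) (here refl)) =
    subst (_< D) (sym (cong₂ _⊔_ (none ax1) (none ax2))) 0<D
    where
    rest↭ : rest ↭ A ++ B
    rest↭ = drop-∷ (↭-trans (↭-sym p) (shift r A B))
    none : ∀ α → viewers α r rest ≡ 0
    none α = viewers-none α r rest apart
      where
      apart : ∀ {z} → z ∈ rest → meets (interval α r) (interval α z) ≡ false
      apart {z} z∈ with meets (interval α r) (interval α z) in m
      ... | false = refl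
      ... | true with ∈-map⁻ _ (L⊆ (∈-++⁺ʳ A (here refl)))
                    | ∈-map⁻ _ (L⊆ (∈-++∷⁺ A (∈-resp-↭ rest↭ z∈)))
      ... | (p , c) , a , refl | (q , c') , b , refl
        with l₁ , l₂ ← meets⇒ (interval α (pt c)) (interval α (pt c')) m =
        ⊥-elim (Unique-++∷⇒∉ A uL (subst (_∈ A ++ B) (sym same) (∈-resp-↭ rest↭ z∈)))
        where
        same : pt c ≡ pt c'
        same = cong (λ e → pt (proj₂ e)) (entry-coord-injective α a b
          (≤-antisym (subst₂ _≤_ (cong proj₁ (interval-pt α c)) (cong proj₂ (interval-pt α c')) l₁)
                     (subst₂ _≤_ (cong proj₁ (interval-pt α c')) (cong proj₂ (interval-pt α c)) l₂)))

-- A family whose members (i , t) may carry a shadow rectangle, the image of t in the simulated family.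
Shadowed : Set
Shadowed = List (ℕ × Rect × Maybe Rect)

bodies : Shadowed → Family
bodies = map (λ a → proj₁ a , proj₁ (proj₂ a))

shadowOf : ℕ × Rect × Maybe Rect → Maybe Rect
shadowOf a = proj₂ (proj₂ a)

shadows : Shadowed → List Rect
shadows = mapMaybe shadowOf

shadowPoints : (ℕ × Point → Maybe Rect) → List (ℕ × Point) → Shadowed
shadowPoints φ = map (λ e → proj₁ e , pt (proj₂ e) , φ e)

bodies-shadowPoints : ∀ φ es → bodies (shadowPoints φ es) ≡ map (λ e → proj₁ e , pt (proj₂ e)) es
bodies-shadowPoints φ es = sym (map-∘ es)

shadows-shadowPoints : ∀ φ es → shadows (shadowPoints φ es) ≡ mapMaybe φ es
shadows-shadowPoints φ es = mapMaybe-map shadowOf _ es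

module Covering (Emb : Point → Point → Set) where

  LowIn HighIn : Axis → Rect → Point → Set
  LowIn α t u = ∃[ u' ] (Emb u u' × lo α t ≤ coord α u')
  HighIn α t v = ∃[ v' ] (Emb v v' × coord α v' ≤ hi α t)

  Covers : Rect → Rect → Set
  Covers s t = ∀ α → Spanned (LowIn α t) (HighIn α t) α s

  Covers-pt : ∀ {u u'} → Emb u u' → Covers (pt u) (pt u')
  Covers-pt {u} {u'} e α = Spanned-pt α (u' , e , ≤-reflexive (cong proj₁ (interval-pt α u')))
                                        (u' , e , ≤-reflexive (cong proj₂ (sym (interval-pt α u'))))

  module _ (α : Axis) {t t' : Rect} where

    widenLowˡ : ∀ {u} → LowIn α t u → LowIn α (boundingBox t t') u
    widenLowˡ (u' , e , le) = u' , e , ≤-trans (≤-reflexive (lo-boundingBox α t t')) (≤-trans (m⊓n≤m _ _) le)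

    widenLowʳ : ∀ {u} → LowIn α t' u → LowIn α (boundingBox t t') u
    widenLowʳ (u' , e , le) = u' , e , ≤-trans (≤-reflexive (lo-boundingBox α t t')) (≤-trans (m⊓n≤n _ _) le)

    widenHighˡ : ∀ {v} → HighIn α t v → HighIn α (boundingBox t t') v
    widenHighˡ (v' , e , le) = v' , e , ≤-trans le (≤-trans (m≤m⊔n _ _) (≤-reflexive (sym (hi-boundingBox α t t'))))

    widenHighʳ : ∀ {v} → HighIn α t' v → HighIn α (boundingBox t t') v
    widenHighʳ (v' , e , le) = v' , e , ≤-trans le (≤-trans (m≤n⊔m _ _) (≤-reflexive (sym (hi-boundingBox α t t'))))

  Covers-widenˡ : ∀ {s t t'} → Covers s t → Covers s (boundingBox t t')
  Covers-widenˡ {s} c α = Spanned-map α {s} (widenLowˡ α) (widenHighˡ α) (c α)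

  Covers-widenʳ : ∀ {s t t'} → Covers s t' → Covers s (boundingBox t t')
  Covers-widenʳ {s} c α = Spanned-map α {s} (widenLowʳ α) (widenHighʳ α) (c α)

  Covers-boundingBox : ∀ {s t s' t'} → Covers s t → Covers s' t' → Covers (boundingBox s s') (boundingBox t t')
  Covers-boundingBox c c' α = Spanned-boundingBox α (Covers-widenˡ c α) (Covers-widenʳ c' α)

-- A d-wide decomposition of the bodies is replayed on the shadows, merging two shadows whenever
-- their bodies merge. `Emb u u'` matches a shadow point u with a body point u', monotonically;
-- the shadows are decomposed beside a context C apart from every `Block`, and `finish` takes
-- over once a single shadow is left.
module Simulation
  (Emb : Point → Point → Set)
  (Emb-mono : ∀ α {u u' v v'} → Emb u u' → Emb v v' → coord α u ≤ coord α v → coord α u' ≤ coord α v')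
  (Block : Rect → Set) (Block-boundingBox : ∀ {s s'} → Block s → Block s' → Block (boundingBox s s'))
  (d D : ℕ) (d≤D : d ≤ D) (C : List Rect)
  (C-apart : ∀ {c s} → c ∈ C → Block s → ∀ α → meets (interval α s) (interval α c) ≡ false)
  (C-wide : WideRects D C)
  (finish : ∀ (Σ : Family) s m → Block s → map proj₂ Σ ↭ s ∷ C → WideDecompFrom D Σ m)
  where

  open Covering Emb

  ends-ordered : ∀ α {s t s' t'} → LowEnd (LowIn α t) α s → HighEnd (HighIn α t') α s' →
    lo α s ≤ hi α s' → lo α t ≤ hi α t'
  ends-ordered α (u , (u' , eu , t≤u') , u≡) (v , (v' , ev , v'≤t') , v≡) s≤s' =
    ≤-trans t≤u' (≤-trans (Emb-mono α eu ev (subst₂ _≤_ (sym u≡) (sym v≡) s≤s')) v'≤t')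

  Covers-meets : ∀ α {s t s' t'} → Covers s t → Covers s' t' →
    meets (interval α s) (interval α s') ≡ true → meets (interval α t) (interval α t') ≡ true
  Covers-meets α c c' m with s≤s' , s'≤s ← meets⇒ _ _ m =
    meets⇐ _ _ (ends-ordered α (proj₁ (c α)) (proj₂ (c' α)) s≤s')
               (ends-ordered α (proj₁ (c' α)) (proj₂ (c α)) s'≤s)

  ShadowOK : Rect → Maybe Rect → Set
  ShadowOK t nothing = ⊤
  ShadowOK t (just s) = Covers s t × Block s

  Valid : Shadowed → Set
  Valid = All (λ a → ShadowOK (proj₁ (proj₂ a)) (proj₂ (proj₂ a)))

  shadowPoints-Valid : ∀ (φ : ℕ × Point → Maybe Rect) (es : List (ℕ × Point)) →
    (∀ {e s} → e ∈ es → φ e ≡ just s → Covers s (pt (proj₂ e)) × Block s) → Valid (shadowPoints φ es)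
  shadowPoints-Valid φ [] ok = []
  shadowPoints-Valid φ (e ∷ es) ok = head ∷ shadowPoints-Valid φ es (λ p → ok (there p))
    where
    head : ShadowOK (pt (proj₂ e)) (φ e)
    head with φ e in φe
    ... | nothing = tt
    ... | just s = ok (here refl) φe

  viewers-shadows≤ : ∀ α {s t} → Covers s t → ∀ ann → Valid ann →
    viewers α s (shadows ann) ≤ viewers α t (map proj₂ (bodies ann))
  viewers-shadows≤ α c [] _ = z≤n
  viewers-shadows≤ α {s} {t} c ((_ , t' , nothing) ∷ ann) (_ ∷ v)
    with meets (interval α t) (interval α t')
  ... | true = m≤n⇒m≤1+n (viewers-shadows≤ α c ann v)
  ... | false = viewers-shadows≤ α c ann v
  viewers-shadows≤ α {s} {t} c ((_ , t' , just s') ∷ ann) ((c' , _) ∷ v)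
    with meets (interval α s) (interval α s') in m | meets (interval α t) (interval α t') in m'
  ... | true | true = s≤s (viewers-shadows≤ α c ann v)
  ... | true | false with () ← trans (sym (Covers-meets α c c' m)) m'
  ... | false | true = m≤n⇒m≤1+n (viewers-shadows≤ α c ann v)
  ... | false | false = viewers-shadows≤ α c ann v

  shadow-Block : ∀ {ann s} → Valid ann → s ∈ shadows ann → Block s
  shadow-Block {ann} v p with ∈-mapMaybe⁻ shadowOf {ann} p
  ... | _ , a∈ , refl = proj₂ (All.lookup v a∈)

  viewers-C-shadows : ∀ {ann r} → Valid ann → r ∈ C → ∀ α → viewers α r (shadows ann) ≡ 0
  viewers-C-shadows {ann} {r} v r∈C α = viewers-none α r (shadows ann) (λ {x} x∈ →
    trans (meets-sym (interval α r) (interval α x)) (C-apart r∈C (shadow-Block v x∈) α))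

  -- the shadow r of (i , t) sees at most what t sees, since C is apart from it
  shadow-viewers≤ : ∀ α Pa i t r Q → Valid (Pa ++ (i , t , just r) ∷ Q) →
    viewers α r (shadows Pa ++ (shadows Q ++ C)) ≤ countView α t (bodies Pa ++ bodies Q)
  shadow-viewers≤ α Pa i t r Q v = begin
    viewers α r (shadows Pa ++ (shadows Q ++ C))
      ≡⟨ cong (viewers α r) (sym (++-assoc (shadows Pa) (shadows Q) C)) ⟩
    viewers α r ((shadows Pa ++ shadows Q) ++ C)
      ≡⟨ viewers-++ α r (shadows Pa ++ shadows Q) C ⟩
    viewers α r (shadows Pa ++ shadows Q) + viewers α r C
      ≡⟨ cong (viewers α r (shadows Pa ++ shadows Q) +_) (viewers-none α r C (λ c∈ → C-apart c∈ r-Block α)) ⟩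
    viewers α r (shadows Pa ++ shadows Q) + 0
      ≡⟨ +-identityʳ _ ⟩
    viewers α r (shadows Pa ++ shadows Q)
      ≡⟨ cong (viewers α r) (sym (mapMaybe-++ shadowOf Pa Q)) ⟩
    viewers α r (shadows (Pa ++ Q))
      ≤⟨ viewers-shadows≤ α r-Covers (Pa ++ Q) (All.tabulate (λ p → All.lookup v (∈-++∷⁺ Pa p))) ⟩
    viewers α t (map proj₂ (bodies (Pa ++ Q)))
      ≡⟨ sym (countView≡viewers α t (bodies (Pa ++ Q))) ⟩
    countView α t (bodies (Pa ++ Q))
      ≡⟨ cong (countView α t) (map-++ _ Pa Q) ⟩
    countView α t (bodies Pa ++ bodies Q) ∎
    where
    open ≤-Reasoning
    r-Covers : Covers r t
    r-Covers = proj₁ (All.lookup v (∈-++⁺ʳ Pa (here refl)))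
    r-Block : Block r
    r-Block = proj₂ (All.lookup v (∈-++⁺ʳ Pa (here refl)))

  shadows-WideRects : ∀ ann → Wide d (bodies ann) → Valid ann → WideRects D (shadows ann ++ C)
  shadows-WideRects ann w v r rest p with ∈-++⁻ (shadows ann) (∈-resp-↭ (↭-sym p) (here refl))
  ... | inj₁ r∈ with ∈-mapMaybe⁻ shadowOf {ann} r∈
  ... | (i , t , .(just r)) , a∈ , refl with ∈-∃++ a∈
  ... | Pa , Q , refl =
    ≤-trans (⊔-<-bound (bound ax1) (bound ax2) (w (bodies Pa) i t (bodies Q) (map-++ _ Pa ((i , t , just r) ∷ Q)))) d≤D
    where
    r-first : shadows (Pa ++ (i , t , just r) ∷ Q) ++ C ↭ r ∷ (shadows Pa ++ (shadows Q ++ C))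
    r-first rewrite mapMaybe-++ shadowOf Pa ((i , t , just r) ∷ Q) | ++-assoc (shadows Pa) (r ∷ shadows Q) C =
      shift r (shadows Pa) (shadows Q ++ C)
    bound : ∀ α → viewers α r rest ≤ countView α t (bodies Pa ++ bodies Q)
    bound α = subst (_≤ _) (sym (viewers-↭ α r (drop-∷ (↭-trans (↭-sym p) r-first))))
                (shadow-viewers≤ α Pa i t r Q v)
  shadows-WideRects ann w v r rest p | inj₂ r∈C with ∈-∃++ r∈C
  ... | A , B , refl = ⊔-<-bound (≤-reflexive (bound ax1)) (≤-reflexive (bound ax2)) (C-wide r (A ++ B) (shift r A B))
    where
    r-first : shadows ann ++ C ↭ r ∷ (shadows ann ++ (A ++ B))
    r-first = ↭-trans (++⁺ˡ (shadows ann) (shift r A B)) (shift r (shadows ann) (A ++ B))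
    bound : ∀ α → viewers α r rest ≡ viewers α r (A ++ B)
    bound α = begin
      viewers α r rest
        ≡⟨ viewers-↭ α r (drop-∷ (↭-trans (↭-sym p) r-first)) ⟩
      viewers α r (shadows ann ++ (A ++ B))
        ≡⟨ viewers-++ α r (shadows ann) (A ++ B) ⟩
      viewers α r (shadows ann) + viewers α r (A ++ B)
        ≡⟨ cong (_+ viewers α r (A ++ B)) (viewers-C-shadows v r∈C α) ⟩
      viewers α r (A ++ B) ∎
      where open ≡-Reasoning

  -- New indices are shifted by K so that they exceed every index of Σ.
  simulate : ∀ {F m} → WideDecompFrom d F m → ∀ (ann : Shadowed) → bodies ann ≡ F → Valid ann →
    (∃[ r ] r ∈ shadows ann) → ∀ (Σ : Family) mσ K → mσ ≤ m + K →
    map proj₂ Σ ↭ shadows ann ++ C → WideDecompFrom D Σ mσ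
  simulate (done _ _) [] refl _ (_ , ()) _ _ _ _ _
  simulate (done _ _) ((_ , _ , nothing) ∷ []) refl _ (_ , ()) _ _ _ _ _
  simulate (done _ _) ((_ , _ , just s) ∷ []) refl ((_ , b) ∷ []) _ Σ mσ _ _ p = finish Σ s mσ b p
  simulate (done _ ()) (_ ∷ _ ∷ _) refl _ _ _ _ _ _ _
  simulate {m = m} (step i j k r r' G w perm m<k rest) ann refl v ne Σ mσ K le p
    with ↭-map-inv (λ a → proj₁ a , proj₁ (proj₂ a)) perm
  ... | (.i , .r , sh₁) ∷ (.j , .r' , sh₂) ∷ H , refl , ann↭ =
    merge sh₁ sh₂ (All-resp-↭ ann↭ v) (proj₁ ne , ∈-resp-↭ (mapMaybe-↭ shadowOf ann↭) (proj₂ ne))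
      (↭-trans p (++⁺ʳ C (mapMaybe-↭ shadowOf ann↭)))
    where
    le' : mσ ≤ k + K
    le' = ≤-trans le (+-monoˡ-≤ K (<⇒≤ m<k))
    merge : ∀ sh₁ sh₂ → Valid ((i , r , sh₁) ∷ (j , r' , sh₂) ∷ H) →
      (∃[ s ] s ∈ shadows ((i , r , sh₁) ∷ (j , r' , sh₂) ∷ H)) →
      map proj₂ Σ ↭ shadows ((i , r , sh₁) ∷ (j , r' , sh₂) ∷ H) ++ C → WideDecompFrom D Σ mσ
    merge (just s₁) (just s₂) ((c₁ , b₁) ∷ (c₂ , b₂) ∷ vH) _ q
      with map-proj₂-↭-∷∷-inv Σ s₁ s₂ (shadows H ++ C) q
    ... | iσ , jσ , G' , Σ↭ , G'≡ =
      step iσ jσ (k + K) s₁ s₂ G' (WideRects⇒Wide Σ (WideRects-resp-↭ p (shadows-WideRects ann w v))) Σ↭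
        (≤-<-trans le (+-monoˡ-< K m<k))
        (simulate rest ((k , boundingBox r r' , just (boundingBox s₁ s₂)) ∷ H) refl
          ((Covers-boundingBox c₁ c₂ , Block-boundingBox b₁ b₂) ∷ vH) (_ , here refl)
          ((k + K , boundingBox s₁ s₂) ∷ G') (k + K) K ≤-refl (↭.prep _ (↭-reflexive G'≡)))
    merge (just s₁) nothing ((c₁ , b₁) ∷ _ ∷ vH) _ q =
      simulate rest ((k , boundingBox r r' , just s₁) ∷ H) refl ((Covers-widenˡ c₁ , b₁) ∷ vH) (s₁ , here refl)
        Σ mσ K le' q
    merge nothing (just s₂) (_ ∷ (c₂ , b₂) ∷ vH) _ q =
      simulate rest ((k , boundingBox r r' , just s₂) ∷ H) refl ((Covers-widenʳ c₂ , b₂) ∷ vH) (s₂ , here refl)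
        Σ mσ K le' q
    merge nothing nothing (_ ∷ _ ∷ vH) ne' q =
      simulate rest ((k , boundingBox r r' , nothing) ∷ H) refl (tt ∷ vH) ne' Σ mσ K le' q

  simulatePoints : ∀ (ρ : Permutation) {m} → WideDecompFrom d (toFamily ρ) m →
    (φ : ℕ × Point → Maybe Rect) →
    (∀ {e s} → e ∈ entries ρ → φ e ≡ just s → Covers s (pt (proj₂ e)) × Block s) →
    (∃[ r ] r ∈ mapMaybe φ (entries ρ)) →
    ∀ (Σ : Family) mσ → map proj₂ Σ ↭ mapMaybe φ (entries ρ) ++ C → WideDecompFrom D Σ mσ
  simulatePoints ρ dec φ ok (r , r∈) Σ mσ p =
    simulate dec (shadowPoints φ (entries ρ)) (bodies-shadowPoints φ (entries ρ)) (shadowPoints-Valid φ (entries ρ) ok)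
      (r , subst (r ∈_) (sym (shadows-shadowPoints φ (entries ρ))) r∈) Σ mσ mσ (m≤n+m mσ _)
      (subst (λ L → map proj₂ Σ ↭ L ++ C) (sym (shadows-shadowPoints φ (entries ρ))) p)

lookupPoint : ℕ → List (ℕ × Point) → Maybe Point
lookupPoint q [] = nothing
lookupPoint q ((p , c) ∷ es) with q ≟ p
... | yes _ = just c
... | no _ = lookupPoint q es

lookupPoint-sound : ∀ q es {c} → lookupPoint q es ≡ just c → (q , c) ∈ es
lookupPoint-sound q ((p , c) ∷ es) e with q ≟ p
lookupPoint-sound q ((.q , c) ∷ es) refl | yes refl = here refl
... | no _ = there (lookupPoint-sound q es e)

lookupPoint-complete : ∀ q es {c} → (q , c) ∈ es → ∃[ c' ] (lookupPoint q es ≡ just c')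
lookupPoint-complete q ((p , c) ∷ es) m with q ≟ p
... | yes _ = c , refl
lookupPoint-complete q ((p , c) ∷ es) (here refl) | no q≢p = ⊥-elim (q≢p refl)
lookupPoint-complete q ((p , c) ∷ es) (there m) | no _ = lookupPoint-complete q es m

_[_↦_] : (ℕ × Point → Maybe Rect) → ℕ → Rect → ℕ × Point → Maybe Rect
(φ [ y ↦ r ]) (q , c) with q ≟ y
... | yes _ = just r
... | no _ = φ (q , c)

↦-here : ∀ φ y r c → (φ [ y ↦ r ]) (y , c) ≡ just r
↦-here φ y r c with y ≟ y
... | yes _ = refl
... | no y≢y = ⊥-elim (y≢y refl)

↦-there : ∀ φ {y q} r c → q ≢ y → (φ [ y ↦ r ]) (q , c) ≡ φ (q , c)
↦-there φ {y} {q} r c q≢y with q ≟ y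
... | yes q≡y = ⊥-elim (q≢y q≡y)
... | no _ = refl

↦-inv : ∀ φ y r e {s} → (φ [ y ↦ r ]) e ≡ just s →
  (proj₁ e ≡ y × s ≡ r) ⊎ (proj₁ e ≢ y × φ e ≡ just s)
↦-inv φ y r (q , c) e with q ≟ y
↦-inv φ y r (q , c) refl | yes q≡y = inj₁ (q≡y , refl)
... | no q≢y = inj₂ (q≢y , e)

module _ (ρ : Permutation) where
  private E = entries ρ

  pointOf : ℕ × Point → Maybe Rect
  pointOf (q , _) = Maybe.map pt (lookupPoint q E)

  pointOf-just⁻ : ∀ {e s} → pointOf e ≡ just s → ∃[ c' ] ((proj₁ e , c') ∈ E × s ≡ pt c')
  pointOf-just⁻ {q , _} e with lookupPoint q E in l
  pointOf-just⁻ {q , _} refl | just c' = c' , lookupPoint-sound q E l , refl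

  pointOf-just⁺ : ∀ {q c'} → (q , c') ∈ E → ∀ c → pointOf (q , c) ≡ just (pt c')
  pointOf-just⁺ {q} m _ with lookupPoint-complete q E m
  ... | c'' , l rewrite l = cong (λ c → just (pt c)) (entry-functional ρ (lookupPoint-sound q E l) m)

  pointOf-injective : ∀ {a b r} → pointOf a ≡ just r → pointOf b ≡ just r → proj₁ a ≡ proj₁ b
  pointOf-injective {a} {b} a↦r b↦r with pointOf-just⁻ {a} a↦r | pointOf-just⁻ {b} b↦r
  ... | c , m , refl | c' , m' , e = coord-injective ρ ax1 m m' (coord-pt-injective ax1 e)

  keepIf keepUnless : ℕ × Point → Maybe Rect
  keepIf (q , c) = Maybe.map (λ _ → pt c) (lookupPoint q E)
  keepUnless (q , c) = Maybe.maybe (λ _ → nothing) (just (pt c)) (lookupPoint q E)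

  keepIf-just⁻ : ∀ {e s} → keepIf e ≡ just s → proj₁ e ∈S ρ × s ≡ pt (proj₂ e)
  keepIf-just⁻ {q , _} e with lookupPoint q E in l
  keepIf-just⁻ {q , _} refl | just _ = entry⇒∈S ρ (lookupPoint-sound q E l) , refl

  keepIf-just⁺ : ∀ {q c} → q ∈S ρ → keepIf (q , c) ≡ just (pt c)
  keepIf-just⁺ {q} q∈ with c' , l ← lookupPoint-complete q E (proj₂ (∈S⇒entry ρ q∈)) rewrite l = refl

  keepUnless-just⁻ : ∀ {e s} → keepUnless e ≡ just s → ¬ (proj₁ e ∈S ρ) × s ≡ pt (proj₂ e)
  keepUnless-just⁻ {q , _} e with lookupPoint q E in l
  keepUnless-just⁻ {q , _} refl | nothing = q∉ , refl
    where
    q∉ : ¬ (q ∈S ρ)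
    q∉ q∈ with _ , l' ← lookupPoint-complete q E (proj₂ (∈S⇒entry ρ q∈)) with () ← trans (sym l) l'

  keepUnless-just⁺ : ∀ {q c} → ¬ (q ∈S ρ) → keepUnless (q , c) ≡ just (pt c)
  keepUnless-just⁺ {q} q∉ with lookupPoint q E in l
  ... | nothing = refl
  ... | just _ = ⊥-elim (q∉ (entry⇒∈S ρ (lookupPoint-sound q E l)))

points-↭-keepIf-keepUnless : ∀ (ρ σ : Permutation) →
  points σ ↭ mapMaybe (keepIf ρ) (entries σ) ++ mapMaybe (keepUnless ρ) (entries σ)
points-↭-keepIf-keepUnless ρ σ = map-↭-mapMaybe-++ (keepIf ρ) (keepUnless ρ) (λ e → pt (proj₂ e)) (entries σ) split
  where
  split : ∀ e → (keepIf ρ e ≡ just (pt (proj₂ e)) × keepUnless ρ e ≡ nothing)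
              ⊎ (keepIf ρ e ≡ nothing × keepUnless ρ e ≡ just (pt (proj₂ e)))
  split (q , c) with lookupPoint q (entries ρ)
  ... | just _ = inj₁ (refl , refl)
  ... | nothing = inj₂ (refl , refl)

-- both sides list the points of σ whose index is an index of ρ
keepIf-↭-pointOf : ∀ (ρ σ : Permutation) → mapMaybe (keepIf ρ) (entries σ) ↭ mapMaybe (pointOf σ) (entries ρ)
keepIf-↭-pointOf ρ σ = Unique-⊆-⊇⇒↭
  (Unique-mapMaybe (keepIf ρ) proj₁ (indicesUniq σ) same)
  (Unique-mapMaybe (pointOf σ) proj₁ (indicesUniq ρ) (λ {a} {b} _ _ → pointOf-injective σ {a} {b}))
  sub sup
  where
  same : ∀ {a b r} → a ∈ entries σ → b ∈ entries σ →
    keepIf ρ a ≡ just r → keepIf ρ b ≡ just r → proj₁ a ≡ proj₁ b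
  same {a} {b} a∈ b∈ ea eb with keepIf-just⁻ ρ {a} ea | keepIf-just⁻ ρ {b} eb
  ... | _ , refl | _ , e = coord-injective σ ax1 a∈ b∈ (coord-pt-injective ax1 e)
  sub : mapMaybe (keepIf ρ) (entries σ) ⊆ mapMaybe (pointOf σ) (entries ρ)
  sub z∈ with (q , c) , qc∈ , e ← ∈-mapMaybe⁻ (keepIf ρ) {entries σ} z∈
    with q∈ , refl ← keepIf-just⁻ ρ {q , c} e
    with c₀ , qc₀∈ ← ∈S⇒entry ρ q∈ = ∈-mapMaybe⁺ (pointOf σ) qc₀∈ (pointOf-just⁺ σ qc∈ c₀)
  sup : mapMaybe (pointOf σ) (entries ρ) ⊆ mapMaybe (keepIf ρ) (entries σ)
  sup z∈ with (q , c) , qc∈ , e ← ∈-mapMaybe⁻ (pointOf σ) {entries ρ} z∈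
    with c' , qc'∈ , refl ← pointOf-just⁻ σ {q , c} e =
    ∈-mapMaybe⁺ (keepIf ρ) qc'∈ (keepIf-just⁺ ρ (entry⇒∈S ρ qc∈))

points-↭-pointOf : ∀ (ρ σ : Permutation) → (∀ {p} → p ∈S ρ → p ∈S σ) →
  points ρ ↭ mapMaybe (pointOf ρ) (entries σ)
points-↭-pointOf ρ σ S⊆ = Unique-⊆-⊇⇒↭ (points-unique ρ)
  (Unique-mapMaybe (pointOf ρ) proj₁ (indicesUniq σ) (λ {a} {b} _ _ → pointOf-injective ρ {a} {b})) sub sup
  where
  sub : points ρ ⊆ mapMaybe (pointOf ρ) (entries σ)
  sub z∈ with (q , c) , qc∈ , refl ← ∈-map⁻ _ z∈
    with c₀ , qc₀∈ ← ∈S⇒entry σ (S⊆ (entry⇒∈S ρ qc∈)) =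
    ∈-mapMaybe⁺ (pointOf ρ) qc₀∈ (pointOf-just⁺ ρ qc∈ c₀)
  sup : mapMaybe (pointOf ρ) (entries σ) ⊆ points ρ
  sup z∈ with (q , c) , _ , e ← ∈-mapMaybe⁻ (pointOf ρ) {entries σ} z∈
    with c' , qc'∈ , refl ← pointOf-just⁻ ρ {q , c} e =
    ∈-map⁺ _ qc'∈

SameIndex : Permutation → Permutation → Point → Point → Set
SameIndex ρ σ u u' = ∃[ q ] ((q , u) ∈ entries ρ × (q , u') ∈ entries σ)

SameIndex-mono : ∀ ρ σ →
  (∀ α {q r} → q ∈S ρ → r ∈S ρ → q ∈S σ → r ∈S σ → Lt ρ α q r → Lt σ α q r) →
  ∀ α {u u' v v'} → SameIndex ρ σ u u' → SameIndex ρ σ v v' → coord α u ≤ coord α v → coord α u' ≤ coord α v'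
SameIndex-mono ρ σ Lt-pres α (q , a , a') (r , b , b') le with ≤⇒≡⊎Lt ρ α a b le
... | inj₁ refl = ≤-reflexive (cong (coord α) (entry-functional σ a' b'))
... | inj₂ l =
  <⇒≤ (Lt-elim σ α (Lt-pres α (entry⇒∈S ρ a) (entry⇒∈S ρ b) (entry⇒∈S σ a') (entry⇒∈S σ b') l) a' b')

simulatePoints-alone : ∀ {d D} (Emb : Point → Point → Set) →
  (∀ α {u u' v v'} → Emb u u' → Emb v v' → coord α u ≤ coord α v → coord α u' ≤ coord α v') → d ≤ D →
  ∀ (ρ : Permutation) {m} → WideDecompFrom d (toFamily ρ) m → (φ : ℕ × Point → Maybe Rect) →
  (∀ {e s} → e ∈ entries ρ → φ e ≡ just s → Covering.Covers Emb s (pt (proj₂ e))) →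
  (∃[ r ] r ∈ mapMaybe φ (entries ρ)) →
  ∀ (Σ : Family) mσ → map proj₂ Σ ↭ mapMaybe φ (entries ρ) → WideDecompFrom D Σ mσ
simulatePoints-alone Emb Emb-mono d≤D ρ dec φ covers ne Σ mσ p =
  Simulation.simulatePoints Emb Emb-mono (λ _ → ⊤) (λ _ _ → tt) _ _ d≤D [] (λ ()) WideRects-[]
    (λ Σ' s m _ q → singleton-WideDecompFrom Σ' s m (≤-trans (WideDecompFrom⇒0< dec) d≤D) q)
    ρ dec φ (λ e∈ φe → covers e∈ φe , tt) ne Σ mσ (subst (map proj₂ Σ ↭_) (sym (++-identityʳ _)) p)

module Substitution (π π' : Permutation) (x : ℕ) (disjoint : ∀ p → p ∈S π → ¬ (p ∈S π'))
  (x∈S : x ∈S π) (π'' : Permutation) (isSub : IsSubstitution π x π' π'') where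
  open Equivalence

  E E' E'' : List (ℕ × Point)
  E = entries π
  E' = entries π'
  E'' = entries π''

  ∈S''⇒ : ∀ {p} → p ∈S π'' → (p ∈S π × p ≢ x) ⊎ p ∈S π'
  ∈S''⇒ {p} = to (proj₁ isSub p)

  inner⊆ : ∀ {p} → p ∈S π' → p ∈S π''
  inner⊆ {p} p∈ = from (proj₁ isSub p) (inj₂ p∈)

  outer⊆ : ∀ {p} → p ∈S π → p ≢ x → p ∈S π''
  outer⊆ {p} p∈ p≢x = from (proj₁ isSub p) (inj₁ (p∈ , p≢x))

  x∉S'' : ¬ (x ∈S π'')
  x∉S'' x∈ with ∈S''⇒ x∈
  ... | inj₁ (_ , x≢x) = x≢x refl
  ... | inj₂ x∈' = disjoint x x∈S x∈'

  entry''≢x : ∀ {q c} → (q , c) ∈ E'' → q ≢ x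
  entry''≢x qc∈ refl = x∉S'' (entry⇒∈S π'' qc∈)

  outer-order : ∀ α p q → p ∈S π → p ≢ x → q ∈S π → q ≢ x → Lt π'' α p q ⇔ Lt π α p q
  outer-order = proj₁ (proj₂ isSub)

  inner-order : ∀ α p q → p ∈S π' → q ∈S π' → Lt π'' α p q ⇔ Lt π' α p q
  inner-order = proj₁ (proj₂ (proj₂ isSub))

  mixed-order : ∀ α p q → p ∈S π → p ≢ x → q ∈S π' → Lt π'' α p q ⇔ Lt π α p x
  mixed-order = proj₂ (proj₂ (proj₂ isSub))

  cx : Point
  cx = proj₁ (∈S⇒entry π x∈S)

  x-entry : (x , cx) ∈ E
  x-entry = proj₂ (∈S⇒entry π x∈S)

  inner-side : ∀ α {p y y'} → p ∈S π → p ≢ x → y ∈S π' → y' ∈S π' → Lt π'' α p y → Lt π'' α p y'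
  inner-side α {p} {y} {y'} p∈ p≢x y∈ y'∈ =
    from (mixed-order α p y' p∈ p≢x y'∈) ∘ to (mixed-order α p y p∈ p≢x y∈)

  -- the point u of π'' stands for the index p of π; x is represented by some y with Y y
  Stands : (ℕ → Set) → ℕ → Point → Set
  Stands Y p u = (p ≢ x × (p , u) ∈ E'') ⊎ (p ≡ x × ∃[ y ] (Y y × (y , u) ∈ E''))

  Stands-Lt : ∀ α {Y p r a b u v} → (∀ {y} → Y y → y ∈S π') →
    (p , a) ∈ E → (r , b) ∈ E → Stands Y p u → Stands Y r v → Lt π α p r → coord α u < coord α v
  Stands-Lt α Y⊆ a b (inj₁ (p≢x , pu)) (inj₁ (r≢x , rv)) l =
    Lt-elim π'' α (from (outer-order α _ _ (entry⇒∈S π a) p≢x (entry⇒∈S π b) r≢x) l) pu rv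
  Stands-Lt α Y⊆ a b (inj₁ (p≢x , pu)) (inj₂ (refl , y , Yy , yv)) l =
    Lt-elim π'' α (from (mixed-order α _ y (entry⇒∈S π a) p≢x (Y⊆ Yy)) l) pu yv
  Stands-Lt α Y⊆ a b (inj₂ (refl , y , Yy , yu)) (inj₁ (r≢x , rv)) l
    with Lt-total π'' α yu rv (λ y≡r → disjoint _ (entry⇒∈S π b) (subst (_∈S π') y≡r (Y⊆ Yy)))
  ... | inj₁ l'' = Lt-elim π'' α l'' yu rv
  ... | inj₂ l'' = ⊥-elim (Lt-asym π α l (to (mixed-order α _ y (entry⇒∈S π b) r≢x (Y⊆ Yy)) l''))
  Stands-Lt α Y⊆ a b (inj₂ (refl , _)) (inj₂ (refl , _)) l = ⊥-elim (Lt-asym π α l l)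

  restrict-inner : ∀ {d''} → (∃[ e ] (e ∈ E')) → HasWideDecomp d'' π'' → HasWideDecomp d'' π'
  restrict-inner ((q , c) , qc∈) dec with c'' , qc''∈ ← ∈S⇒entry π'' (inner⊆ (entry⇒∈S π' qc∈)) =
    simulatePoints-alone (SameIndex π' π'')
      (SameIndex-mono π' π'' (λ α q∈ r∈ _ _ → from (inner-order α _ _ q∈ r∈))) ≤-refl
      π'' dec (pointOf π') covers (pt c , ∈-mapMaybe⁺ (pointOf π') qc''∈ (pointOf-just⁺ π' qc∈ c''))
      (toFamily π') _ (subst (_↭ mapMaybe (pointOf π') E'') (sym (points-rects π')) (points-↭-pointOf π' π'' inner⊆))
    where
    open Covering (SameIndex π' π'')
    covers : ∀ {e s} → e ∈ E'' → pointOf π' e ≡ just s → Covers s (pt (proj₂ e))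
    covers {q , c} qc∈ e with c' , qc'∈ , refl ← pointOf-just⁻ π' {q , c} e = Covers-pt (q , qc'∈ , qc∈)

  -- w(π) ≤ w(π''): collapse S' onto one of its indices y
  module Collapse (y : ℕ) (y∈S' : y ∈S π') where

    cy : Point
    cy = proj₁ (∈S⇒entry π'' (inner⊆ y∈S'))

    y-entry : (y , cy) ∈ E''
    y-entry = proj₂ (∈S⇒entry π'' (inner⊆ y∈S'))

    Stands-functional : ∀ {p u v} → Stands (_≡ y) p u → Stands (_≡ y) p v → u ≡ v
    Stands-functional (inj₁ (_ , pu)) (inj₁ (_ , pv)) = entry-functional π'' pu pv
    Stands-functional (inj₁ (p≢x , _)) (inj₂ (p≡x , _)) = ⊥-elim (p≢x p≡x)
    Stands-functional (inj₂ (p≡x , _)) (inj₁ (p≢x , _)) = ⊥-elim (p≢x p≡x)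
    Stands-functional (inj₂ (_ , _ , refl , yu)) (inj₂ (_ , _ , refl , yv)) = entry-functional π'' yu yv

    Emb : Point → Point → Set
    Emb u u' = ∃[ p ] ((p , u) ∈ E × Stands (_≡ y) p u')

    Emb-mono : ∀ α {u u' v v'} → Emb u u' → Emb v v' → coord α u ≤ coord α v → coord α u' ≤ coord α v'
    Emb-mono α (p , a , sp) (r , b , sr) le with ≤⇒≡⊎Lt π α a b le
    ... | inj₁ refl = ≤-reflexive (cong (coord α) (Stands-functional sp sr))
    ... | inj₂ l = <⇒≤ (Stands-Lt α (λ { refl → y∈S' }) a b sp sr l)

    open Covering Emb

    φ : ℕ × Point → Maybe Rect
    φ = pointOf π [ y ↦ pt cx ]

    covers : ∀ {e s} → e ∈ E'' → φ e ≡ just s → Covers s (pt (proj₂ e))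
    covers {q , c} qc∈ e with ↦-inv (pointOf π) y (pt cx) (q , c) e
    ... | inj₁ (refl , refl) = Covers-pt (x , x-entry , inj₂ (refl , y , refl , qc∈))
    ... | inj₂ (_ , e') with c' , qc'∈ , refl ← pointOf-just⁻ π {q , c} e' =
      Covers-pt (q , qc'∈ , inj₁ (entry''≢x qc∈ , qc∈))

    x-image : ∀ {q c} → (q , c) ∈ E → pt cx ≡ pt c → q ≡ x
    x-image qc∈ e = sym (coord-injective π ax1 x-entry qc∈ (coord-pt-injective ax1 e))

    φ-unique : Unique (mapMaybe φ E'')
    φ-unique = Unique-mapMaybe φ proj₁ (indicesUniq π'') same
      where
      same : ∀ {a b r} → a ∈ E'' → b ∈ E'' → φ a ≡ just r → φ b ≡ just r → proj₁ a ≡ proj₁ b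
      same {qa , ca} {qb , cb} a∈ b∈ ea eb
        with ↦-inv (pointOf π) y (pt cx) (qa , ca) ea | ↦-inv (pointOf π) y (pt cx) (qb , cb) eb
      ... | inj₁ (qa≡y , _) | inj₁ (qb≡y , _) = trans qa≡y (sym qb≡y)
      ... | inj₁ (_ , refl) | inj₂ (_ , eb') with c' , qc'∈ , e ← pointOf-just⁻ π {qb , cb} eb' =
        ⊥-elim (entry''≢x b∈ (x-image qc'∈ e))
      ... | inj₂ (_ , ea') | inj₁ (_ , refl) with c' , qc'∈ , e ← pointOf-just⁻ π {qa , ca} ea' =
        ⊥-elim (entry''≢x a∈ (x-image qc'∈ e))
      ... | inj₂ (_ , ea') | inj₂ (_ , eb') = pointOf-injective π {qa , ca} {qb , cb} ea' eb'

    points-↭-φ : points π ↭ mapMaybe φ E''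
    points-↭-φ = Unique-⊆-⊇⇒↭ (points-unique π) φ-unique sub sup
      where
      sub : points π ⊆ mapMaybe φ E''
      sub z∈ with (q , c) , qc∈ , refl ← ∈-map⁻ _ z∈ with q ≟ x
      ... | yes refl = subst (λ c → pt c ∈ mapMaybe φ E'') (entry-functional π x-entry qc∈)
                         (∈-mapMaybe⁺ φ y-entry (↦-here (pointOf π) y (pt cx) cy))
      ... | no q≢x with c'' , qc''∈ ← ∈S⇒entry π'' (outer⊆ (entry⇒∈S π qc∈) q≢x) =
        ∈-mapMaybe⁺ φ qc''∈ (trans (↦-there (pointOf π) (pt cx) c'' q≢y) (pointOf-just⁺ π qc∈ c''))
        where
        q≢y : q ≢ y
        q≢y refl = disjoint q (entry⇒∈S π qc∈) y∈S'
      sup : mapMaybe φ E'' ⊆ points π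
      sup z∈ with (q , c) , _ , e ← ∈-mapMaybe⁻ φ {E''} z∈ with ↦-inv (pointOf π) y (pt cx) (q , c) e
      ... | inj₁ (_ , refl) = ∈-map⁺ _ x-entry
      ... | inj₂ (_ , e') with c' , qc'∈ , refl ← pointOf-just⁻ π {q , c} e' = ∈-map⁺ _ qc'∈

    restrict-outer : ∀ {d''} → HasWideDecomp d'' π'' → HasWideDecomp d'' π
    restrict-outer dec =
      simulatePoints-alone Emb Emb-mono ≤-refl π'' dec φ covers
        (pt cx , ∈-mapMaybe⁺ φ y-entry (↦-here (pointOf π) y (pt cx) cy))
        (toFamily π) _ (subst (_↭ mapMaybe φ E'') (sym (points-rects π)) points-↭-φ)

  -- w(π'') ≤ max(w(π), w(π')): decompose S' first, then π with x ↦ the block of S'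
  Inner : Point → Set
  Inner u = ∃[ y ] (y ∈S π' × (y , u) ∈ E'')

  InnerBlock : Rect → Set
  InnerBlock s = ∀ α → Spanned Inner Inner α s

  InnerBlock-boundingBox : ∀ {s s'} → InnerBlock s → InnerBlock s' → InnerBlock (boundingBox s s')
  InnerBlock-boundingBox b b' α = Spanned-boundingBox α (b α) (b' α)

  outerPoints : List Rect
  outerPoints = mapMaybe (keepUnless π') E''

  outerPoints⁻ : ∀ {z} → z ∈ outerPoints → ∃[ q ] ∃[ c ] ((q , c) ∈ E'' × (q ∈S π × q ≢ x) × z ≡ pt c)
  outerPoints⁻ z∈ with (q , c) , qc∈ , e ← ∈-mapMaybe⁻ (keepUnless π') {E''} z∈
                     with q∉ , refl ← keepUnless-just⁻ π' {q , c} e with ∈S''⇒ (entry⇒∈S π'' qc∈)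
  ... | inj₁ q-outer = q , c , qc∈ , q-outer , refl
  ... | inj₂ q∈S' = ⊥-elim (q∉ q∈S')

  outerPoints⁺ : ∀ {q c} → (q , c) ∈ E'' → q ∈S π → pt c ∈ outerPoints
  outerPoints⁺ {q} qc∈ q∈S = ∈-mapMaybe⁺ (keepUnless π') qc∈ (keepUnless-just⁺ π' (disjoint q q∈S))

  outerPoints-unique : Unique outerPoints
  outerPoints-unique = Unique-mapMaybe (keepUnless π') proj₁ (indicesUniq π'') same
    where
    same : ∀ {a b r} → a ∈ E'' → b ∈ E'' →
      keepUnless π' a ≡ just r → keepUnless π' b ≡ just r → proj₁ a ≡ proj₁ b
    same {a} {b} a∈ b∈ ea eb with keepUnless-just⁻ π' {a} ea | keepUnless-just⁻ π' {b} eb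
    ... | _ , refl | _ , e = coord-injective π'' ax1 a∈ b∈ (coord-pt-injective ax1 e)

  -- S' is an interval of π'' on both axes, so its blocks see no outer point
  outerPoints-apart : ∀ {c s} → c ∈ outerPoints → InnerBlock s →
    ∀ α → meets (interval α s) (interval α c) ≡ false
  outerPoints-apart {c} {s} c∈ b α with meets (interval α s) (interval α c) in m
  ... | false = refl
  ... | true with outerPoints⁻ c∈ | b α
  ... | q , cq , qc∈ , (q∈S , q≢x) , refl | (u , (y₁ , y₁∈S' , y₁u) , u≡) , (v , (y₂ , y₂∈S' , y₂v) , v≡)
    with lo≤ , ≤hi ← meets⇒ (interval α s) (interval α (pt cq)) m =
    ⊥-elim (Lt-asym π'' α y₁<q (inner-side α q∈S q≢x y₂∈S' y₁∈S' q<y₂))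
    where
    y₁<q : Lt π'' α y₁ q
    y₁<q = ≤⇒Lt π'' α (λ { refl → disjoint y₁ q∈S y₁∈S' }) y₁u qc∈
      (subst₂ _≤_ (sym u≡) (cong proj₂ (interval-pt α cq)) lo≤)
    q<y₂ : Lt π'' α q y₂
    q<y₂ = ≤⇒Lt π'' α (λ { refl → disjoint q q∈S y₂∈S' }) qc∈ y₂v
      (subst₂ _≤_ (cong proj₁ (interval-pt α cq)) (sym v≡) ≤hi)

  InnerBlock∉outerPoints : ∀ {s} → InnerBlock s → s ∉ outerPoints
  InnerBlock∉outerPoints b s∈ with q , cq , _ , _ , refl ← outerPoints⁻ s∈
    with () ← trans (sym (outerPoints-apart s∈ b ax1))
                    (meets⇐ (interval ax1 (pt cq)) (interval ax1 (pt cq)) ≤-refl ≤-refl)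

  Emb₂ : Point → Point → Set
  Emb₂ u u' = ∃[ p ] ((p , u') ∈ E × Stands (_∈S π') p u)

  Emb₂-mono : ∀ α {u u' v v'} → Emb₂ u u' → Emb₂ v v' → coord α u ≤ coord α v → coord α u' ≤ coord α v'
  Emb₂-mono α (p , a , sp) (r , b , sr) le with p ≟ r
  ... | yes refl = ≤-reflexive (cong (coord α) (entry-functional π a b))
  ... | no p≢r with Lt-total π α a b p≢r
  ... | inj₁ l = <⇒≤ (Lt-elim π α l a b)
  ... | inj₂ l = ⊥-elim (<⇒≱ (Stands-Lt α (λ y∈ → y∈) b a sr sp l) le)

  module _ (s : Rect) (b : InnerBlock s) where
    open Covering Emb₂

    φ₂ : ℕ × Point → Maybe Rect
    φ₂ = pointOf π'' [ x ↦ s ]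

    covers₂ : ∀ {e z} → e ∈ E → φ₂ e ≡ just z → Covers z (pt (proj₂ e))
    covers₂ {q , c} qc∈ e with ↦-inv (pointOf π'') x s (q , c) e
    ... | inj₁ (refl , refl) = λ α → Spanned-map α (low α) (high α) (b α)
      where
      low : ∀ α {u} → Inner u → LowIn α (pt c) u
      low α (y , y∈S' , yu) = c , (x , qc∈ , inj₂ (refl , y , y∈S' , yu)) , ≤-reflexive (cong proj₁ (interval-pt α c))
      high : ∀ α {v} → Inner v → HighIn α (pt c) v
      high α (y , y∈S' , yv) =
        c , (x , qc∈ , inj₂ (refl , y , y∈S' , yv)) , ≤-reflexive (cong proj₂ (sym (interval-pt α c)))
    ... | inj₂ (q≢x , e') with c'' , qc''∈ , refl ← pointOf-just⁻ π'' {q , c} e' =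
      Covers-pt (q , qc∈ , inj₁ (q≢x , qc''∈))

    φ₂-unique : Unique (mapMaybe φ₂ E)
    φ₂-unique = Unique-mapMaybe φ₂ proj₁ (indicesUniq π) same
      where
      same : ∀ {a b r} → a ∈ E → b ∈ E → φ₂ a ≡ just r → φ₂ b ≡ just r → proj₁ a ≡ proj₁ b
      same {qa , ca} {qb , cb} a∈ b∈ ea eb
        with ↦-inv (pointOf π'') x s (qa , ca) ea | ↦-inv (pointOf π'') x s (qb , cb) eb
      ... | inj₁ (qa≡x , _) | inj₁ (qb≡x , _) = trans qa≡x (sym qb≡x)
      ... | inj₁ (_ , refl) | inj₂ (_ , eb') with c'' , qc''∈ , refl ← pointOf-just⁻ π'' {qb , cb} eb' =
        ⊥-elim (InnerBlock∉outerPoints b (outerPoints⁺ qc''∈ (entry⇒∈S π b∈)))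
      ... | inj₂ (_ , ea') | inj₁ (_ , refl) with c'' , qc''∈ , refl ← pointOf-just⁻ π'' {qa , ca} ea' =
        ⊥-elim (InnerBlock∉outerPoints b (outerPoints⁺ qc''∈ (entry⇒∈S π a∈)))
      ... | inj₂ (_ , ea') | inj₂ (_ , eb') = pointOf-injective π'' {qa , ca} {qb , cb} ea' eb'

    block∷outerPoints-↭-φ₂ : s ∷ outerPoints ↭ mapMaybe φ₂ E
    block∷outerPoints-↭-φ₂ = Unique-⊆-⊇⇒↭
      (All.tabulate (λ z∈ s≡z → InnerBlock∉outerPoints b (subst (_∈ outerPoints) (sym s≡z) z∈)) ∷ outerPoints-unique)
      φ₂-unique sub sup
      where
      sub : s ∷ outerPoints ⊆ mapMaybe φ₂ E
      sub (here refl) = ∈-mapMaybe⁺ φ₂ x-entry (↦-here (pointOf π'') x s cx)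
      sub (there z∈) with q , cq , qc∈ , (q∈S , q≢x) , refl ← outerPoints⁻ z∈
                     with c , qc'∈ ← ∈S⇒entry π q∈S =
        ∈-mapMaybe⁺ φ₂ qc'∈ (trans (↦-there (pointOf π'') s c q≢x) (pointOf-just⁺ π'' qc∈ c))
      sup : mapMaybe φ₂ E ⊆ s ∷ outerPoints
      sup z∈ with (q , c) , qc∈ , e ← ∈-mapMaybe⁻ φ₂ {E} z∈ with ↦-inv (pointOf π'') x s (q , c) e
      ... | inj₁ (_ , refl) = here refl
      ... | inj₂ (_ , e') with c'' , qc''∈ , refl ← pointOf-just⁻ π'' {q , c} e' =
        there (outerPoints⁺ qc''∈ (entry⇒∈S π qc∈))

  place-outer : ∀ {d D} → HasWideDecomp d π → d ≤ D →
    ∀ (Σ : Family) s m → InnerBlock s → map proj₂ Σ ↭ s ∷ outerPoints → WideDecompFrom D Σ m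
  place-outer dec d≤D Σ s m b p =
    simulatePoints-alone Emb₂ Emb₂-mono d≤D π dec (φ₂ s b) (covers₂ s b)
      (s , ∈-mapMaybe⁺ (φ₂ s b) x-entry (↦-here (pointOf π'') x s cx))
      Σ m (↭-trans p (block∷outerPoints-↭-φ₂ s b))

  assemble : ∀ {d d'} → HasWideDecomp d π → HasWideDecomp d' π' → HasWideDecomp (d ⊔ d') π''
  assemble {d} {d'} dec dec' with (q , c) , qc∈ ← HasWideDecomp-nonempty π' dec'
                                 with c'' , qc''∈ ← ∈S⇒entry π'' (inner⊆ (entry⇒∈S π' qc∈)) =
    Simulation.simulatePoints (SameIndex π'' π')
      (SameIndex-mono π'' π' (λ α _ _ q∈ r∈ → to (inner-order α _ _ q∈ r∈)))
      InnerBlock InnerBlock-boundingBox d' (d ⊔ d') (m≤n⊔m d d') outerPoints outerPoints-apart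
      (points-WideRects π'' outerPoints 0<D outerPoints-unique outer⊆points)
      (λ Σ s m → place-outer dec (m≤m⊔n d d') Σ s m)
      π' dec' (pointOf π'') ok (pt c'' , ∈-mapMaybe⁺ (pointOf π'') qc∈ (pointOf-just⁺ π'' qc''∈ c))
      (toFamily π'') _
      (subst (_↭ mapMaybe (pointOf π'') E' ++ outerPoints) (sym (points-rects π''))
        (↭-trans (points-↭-keepIf-keepUnless π' π'') (++⁺ʳ outerPoints (keepIf-↭-pointOf π' π''))))
    where
    open Covering (SameIndex π'' π')
    0<D : 0 < d ⊔ d'
    0<D = ≤-trans (WideDecompFrom⇒0< dec) (m≤m⊔n d d')
    outer⊆points : outerPoints ⊆ points π''
    outer⊆points z∈ with _ , _ , qc∈ , _ , refl ← outerPoints⁻ z∈ = ∈-map⁺ _ qc∈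
    ok : ∀ {e z} → e ∈ E' → pointOf π'' e ≡ just z → Covers z (pt (proj₂ e)) × InnerBlock z
    ok {q , c} qc∈ e with c'' , qc''∈ , refl ← pointOf-just⁻ π'' {q , c} e =
      Covers-pt (q , qc''∈ , qc∈) , λ α → Spanned-pt α inner inner
      where
      inner : Inner c''
      inner = q , entry⇒∈S π' qc∈ , qc''∈

proposition2 : (π π' : Permutation) (x : ℕ) →
    (∀ p → p ∈S π → ¬ (p ∈S π')) →
    x ∈S π →
    (π'' : Permutation) → IsSubstitution π x π' π'' →
    (d d' : ℕ) → IsWidth π d → IsWidth π' d' →
    IsWidth π'' (d ⊔ d')
proposition2 π π' x disjoint x∈S π'' isSub d d' (dec , least) (dec' , least') =
  assemble dec dec' , λ d'' dec'' → ⊔-lub (least d'' (restrict-outer dec'')) (least' d'' (restrict-inner e' dec''))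
  where
  open Substitution π π' x disjoint x∈S π'' isSub
  e' : ∃[ e ] (e ∈ entries π')
  e' = HasWideDecomp-nonempty π' dec'
  open Collapse (proj₁ (proj₁ e')) (entry⇒∈S π' (proj₂ e'))
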